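{- Let $k\ge 2$ and $r\ge 1$ be integers and let $c:\mathbb{N}\to\{1,\dots,r\}$ be an exact $r$-coloring that is rainbow-free for $x-y=z^k$. Then $c(1)$ is a dominant color.
   Context: Here $\mathbb{N}=\{1,2,\dots\}$; an exact $r$-coloring is a surjective map. A rainbow solution to $x-y=z^k$ is an ordered triple $(a_1,a_2,a_3)$ of positive integers with $a_1-a_2=a_3^k$ and $c(a_1),c(a_2),c(a_3)$ pairwise distinct; rainbow-free means no such triple exists. A string of length $\ell$ at position $i$ is $\{i,i+1,\dots,i+\ell-1\}$; it is bichromatic if it contains exactly two colors. A color is dominant if every bichromatic string contains an element of that color. -}

module Defs where

open import Data.Nat using (ℕ; _+_; _^_; _≤_; _<_)
open import Data.Fin using (Fin)
open import Data.Product using (Σ; ∃; _×_; _,_)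
open import Data.Sum using (_⊎_)
open import Relation.Nullary using (¬_)
open import Relation.Binary.PropositionalEquality using (_≡_)

-- Colorings of ℕ = {1,2,...}: a function c : ℕ → Fin r whose value at 0 is
-- irrelevant (every notion below only inspects positive arguments).
Coloring : ℕ → Set
Coloring r = ℕ → Fin r

Exact : {r : ℕ} → Coloring r → Set
Exact {r} c = (col : Fin r) → Σ ℕ λ n → (1 ≤ n) × (c n ≡ col)

RainbowSolution : {r : ℕ} → ℕ → Coloring r → ℕ → ℕ → ℕ → Set
RainbowSolution k c a₁ a₂ a₃ =
  (1 ≤ a₁) × (1 ≤ a₂) × (1 ≤ a₃) × (a₁ ≡ a₂ + a₃ ^ k) ×
  (¬ c a₁ ≡ c a₂) × (¬ c a₁ ≡ c a₃) × (¬ c a₂ ≡ c a₃)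

RainbowFree : {r : ℕ} → ℕ → Coloring r → Set
RainbowFree k c = ∀ a₁ a₂ a₃ → ¬ RainbowSolution k c a₁ a₂ a₃

InString : ℕ → ℕ → ℕ → Set
InString i ℓ j = (i ≤ j) × (j < i + ℓ)

Bichromatic : {r : ℕ} → Coloring r → ℕ → ℕ → Set
Bichromatic {r} c i ℓ =
  Σ (Fin r) λ a → Σ (Fin r) λ b →
    (¬ a ≡ b) ×
    (∀ j → InString i ℓ j → (c j ≡ a) ⊎ (c j ≡ b)) ×
    (Σ ℕ λ j → InString i ℓ j × (c j ≡ a)) ×
    (Σ ℕ λ j → InString i ℓ j × (c j ≡ b))

Dominant : {r : ℕ} → Coloring r → Fin r → Set
Dominant c d = ∀ i ℓ → 1 ≤ i → Bichromatic c i ℓ →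
  Σ ℕ λ j → InString i ℓ j × (c j ≡ d)

-- Since 1 ^ k = 1, every triple (j + 1, j, 1) solves x - y = z ^ k. Rainbow-freeness
-- therefore forces two consecutive integers to share a color unless one of them has
-- color c 1. A string missing the color c 1 is thus monochromatic, so every
-- bichromatic string meets c 1.
module Submission where

open import Defs
open import Data.Nat using (ℕ; _≤_; _<_; _+_; _^_; suc; s≤s)
open import Data.Nat.Properties using (≤-trans; ≤-refl; n≤1+n; <-trans; n<1+n; m≤n⇒m<n∨m≡n; +-comm; ^-zeroˡ)
open import Data.Fin using (_≟_)
open import Data.Product using (_,_)
open import Data.Sum using (inj₁; inj₂)
open import Data.Empty using (⊥-elim)
open import Relation.Nullary using (¬_; yes; no)
open import Relation.Binary.PropositionalEquality using (_≡_; refl; sym; trans; cong; module ≡-Reasoning)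

successor-difference-is-power : ∀ k j → suc j ≡ j + 1 ^ k
successor-difference-is-power k j = trans (+-comm 1 j) (cong (j +_) (sym (^-zeroˡ k)))

stepwiseConstant⇒constantOnString : ∀ {A : Set} (f : ℕ → A) {i ℓ} →
  (∀ j → i ≤ j → suc j < i + ℓ → f (suc j) ≡ f j) →
  ∀ j → InString i ℓ j → f j ≡ f i
stepwiseConstant⇒constantOnString f step j (i≤j , j<i+ℓ) with m≤n⇒m<n∨m≡n i≤j
... | inj₂ refl = refl
stepwiseConstant⇒constantOnString f step (suc j) (_ , 1+j<i+ℓ) | inj₁ (s≤s i≤j) =
  trans (step j i≤j 1+j<i+ℓ)
        (stepwiseConstant⇒constantOnString f step j (i≤j , <-trans (n<1+n j) 1+j<i+ℓ))

module _ {k r : ℕ} {c : Coloring r} (rainbowFree : RainbowFree k c) where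

  successor-sameColor : ∀ {j} → 1 ≤ j → ¬ c (suc j) ≡ c 1 → ¬ c j ≡ c 1 →
                        c (suc j) ≡ c j
  successor-sameColor {j} 1≤j c[1+j]≢c1 c[j]≢c1 with c (suc j) ≟ c j
  ... | yes same = same
  ... | no differ = ⊥-elim (rainbowFree (suc j) j 1
        (≤-trans 1≤j (n≤1+n j) , 1≤j , ≤-refl , successor-difference-is-power k j ,
         differ , c[1+j]≢c1 , c[j]≢c1))

  avoidsColor1⇒monochromatic : ∀ {i ℓ} → 1 ≤ i →
    (∀ j → InString i ℓ j → ¬ c j ≡ c 1) →
    ∀ j → InString i ℓ j → c j ≡ c i
  avoidsColor1⇒monochromatic {i} 1≤i avoids = stepwiseConstant⇒constantOnString c step
    where
      step : ∀ j → i ≤ j → suc j < i + _ → c (suc j) ≡ c j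
      step j i≤j 1+j<i+ℓ = successor-sameColor (≤-trans 1≤i i≤j)
        (avoids (suc j) (≤-trans i≤j (n≤1+n j) , 1+j<i+ℓ))
        (avoids j (i≤j , <-trans (n<1+n j) 1+j<i+ℓ))

mainTheorem9 : (k r : ℕ) → 2 ≤ k → 1 ≤ r → (c : Coloring r) →
    Exact c → RainbowFree k c → Dominant c (c 1)
mainTheorem9 k r _ _ c _ rainbowFree i ℓ 1≤i
  (a , b , a≢b , twoColors , (ja , ja∈ , c[ja]≡a) , (jb , jb∈ , c[jb]≡b))
  with c 1 ≟ a | c 1 ≟ b
... | yes c1≡a | _ = ja , ja∈ , trans c[ja]≡a (sym c1≡a)
... | no _ | yes c1≡b = jb , jb∈ , trans c[jb]≡b (sym c1≡b)
... | no c1≢a | no c1≢b = ⊥-elim (a≢b (begin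
  a    ≡⟨ sym c[ja]≡a ⟩
  c ja ≡⟨ monochromatic ja ja∈ ⟩
  c i  ≡⟨ sym (monochromatic jb jb∈) ⟩
  c jb ≡⟨ c[jb]≡b ⟩
  b    ∎))
  where
    open ≡-Reasoning
    avoids : ∀ j → InString i ℓ j → ¬ c j ≡ c 1
    avoids j j∈ c[j]≡c1 with twoColors j j∈
    ... | inj₁ c[j]≡a = c1≢a (trans (sym c[j]≡c1) c[j]≡a)
    ... | inj₂ c[j]≡b = c1≢b (trans (sym c[j]≡c1) c[j]≡b)
    monochromatic : ∀ j → InString i ℓ j → c j ≡ c i
    monochromatic = avoidsColor1⇒monochromatic {k = k} rainbowFree 1≤i avoids
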